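{- Let $S$ be a set or multiset of positive integers. Then $\mathsf{S}(z,q)=\prod_{\ell\in S}(1+zq^\ell)(1+z^{ -1}q^\ell)\in\mathscr{T}_{z,q}^2$. In particular, $d_S(m,n)>d_S(m+2,n)$ for all integers $m,n\ge0$ such that $d_S(m,n)\ne0$, where $\mathsf{S}(z,q)=\sum_{n\ge0}\sum_{m\in\mathbb{Z}}d_S(m,n)z^mq^n$.
   Context: Each element of $S$ has finite multiplicity, so the product is a power series in $q$ whose coefficients are Laurent polynomials in $z$. $\mathscr{T}_z^2$ is the set of Laurent polynomials $\sum_ic_iz^i$ with real $c_i\ge0$, $c_{ -i}=c_i$, and for $r\in\{0,1\}$, $\ell\ge0$: $c_{r+2\ell}\ge c_{r+2(\ell+1)}$, with strict inequality whenever $c_{r+2\ell}>0$. A series $\sum_nC_n(z)q^n$ lies in $\mathscr{T}_{z,q}^2$ if every $C_n(z)\in\mathscr{T}_z^2$. -}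

module Defs where

open import Data.Nat using (ℕ; zero; suc; _+_; _*_; _≤_; _<_)
open import Data.Integer as ℤ using (ℤ; +_)
open import Data.List using (List; []; _∷_; _++_; map; concatMap; filter)
open import Data.Nat.ListAction using (sum)
open import Data.Product using (_×_; _,_)
open import Relation.Binary.PropositionalEquality using (_≡_; _≢_)
open import Relation.Nullary.Decidable using (_×-dec_)
import Data.Nat.Properties as ℕP
import Data.Integer.Properties as ℤP

record Mono : Set where
  constructor mono
  field
    coeff : ℕ
    zexp  : ℤ
    qexp  : ℕ
open Mono public

-- A polynomial in z, z⁻¹, q, represented as a formal sum (list) of monomials.
Poly : Set
Poly = List Mono

one : Poly
one = mono 1 (+ 0) 0 ∷ []

_⊕_ : Poly → Poly → Poly
p ⊕ r = p ++ r

_⊗_ : Poly → Poly → Poly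
p ⊗ r = concatMap (λ a → map (λ b → mono (coeff a * coeff b) (zexp a ℤ.+ zexp b) (qexp a + qexp b)) r) p

_^ᵖ_ : Poly → ℕ → Poly
p ^ᵖ zero = one
p ^ᵖ suc k = p ⊗ (p ^ᵖ k)

factor : ℕ → Poly
factor ℓ = (one ⊕ (mono 1 (+ 1) ℓ ∷ [])) ⊗ (one ⊕ (mono 1 (ℤ.- (+ 1)) ℓ ∷ []))

-- A multiset S of positive integers is given by its multiplicity function:
-- mult ℓ = multiplicity of ℓ in S (only ℓ ≥ 1 is used; each multiplicity finite).
-- prodUpTo mult N = ∏_{ℓ=1}^{N} ((1 + z q^ℓ)(1 + z⁻¹ q^ℓ))^{mult ℓ}
prodUpTo : (ℕ → ℕ) → ℕ → Poly
prodUpTo mult zero = one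
prodUpTo mult (suc N) = (factor (suc N) ^ᵖ mult (suc N)) ⊗ prodUpTo mult N

coeffAt : Poly → ℤ → ℕ → ℕ
coeffAt p m n = sum (map coeff (filter (λ a → (zexp a ℤP.≟ m) ×-dec (qexp a ℕP.≟ n)) p))

-- Factors with ℓ > n are 1 + O(q^{n+1}) and do not affect the q^n coefficient,
-- so it is computed from the finite product over ℓ ≤ n.
dS : (ℕ → ℕ) → ℤ → ℕ → ℕ
dS mult m n = coeffAt (prodUpTo mult n) m n

-- 𝒯²_z for a coefficient function c : ℤ → ℕ (c_i ≥ 0 automatic):
-- symmetric, and for r ∈ {0,1}, ℓ ≥ 0: c_{r+2ℓ} ≥ c_{r+2(ℓ+1)}, strict when c_{r+2ℓ} > 0.
InT2z : (ℤ → ℕ) → Set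
InT2z c =
  (∀ i → c (ℤ.- i) ≡ c i) ×
  (∀ (r ℓ : ℕ) → r ≤ 1 →
     (c (+ (r + 2 * (ℓ + 1))) ≤ c (+ (r + 2 * ℓ))) ×
     (0 < c (+ (r + 2 * ℓ)) → c (+ (r + 2 * (ℓ + 1))) < c (+ (r + 2 * ℓ))))

InT2zq : (ℤ → ℕ → ℕ) → Set
InT2zq d = ∀ (n : ℕ) → InT2z (λ m → d m n)

{-# OPTIONS --safe #-}
-- A coefficient function c : ℤ → ℕ is in T² when it is symmetric and, along
-- k ≥ 0, c (k + 2) ≤ c k with strict inequality wherever c k > 0.  This class
-- contains 0 and is closed under sums and under multiplication by z + z⁻¹.
-- Since (1 + z q^ℓ)(1 + z⁻¹ q^ℓ) = 1 + (z + z⁻¹) q^ℓ + q^(2ℓ), multiplying a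
-- series by one factor turns its q^n coefficient into
-- C_n + (z + z⁻¹) C_(n-ℓ) + C_(n-2ℓ), so if every C_n is in T², so is every
-- new coefficient.
module Submission where

open import Defs
open import Data.Nat using (ℕ; _<_)
open import Data.Integer using (ℤ; +_; _+_)
open import Data.Product using (_×_)
open import Relation.Binary.PropositionalEquality using (_≢_)

open import Data.Nat as ℕ using (zero; suc; _≤_; _∸_; z≤n; s≤s; _≤?_)
import Data.Nat.Properties as ℕP
open import Data.Nat.Solver using (module +-*-Solver)
open import Data.Integer using (-_; _-_; 0ℤ; 1ℤ; -1ℤ)
import Data.Integer.Properties as ℤP
open import Algebra.Properties.AbelianGroup ℤP.+-0-abelianGroup using (xyx⁻¹≈y)
open import Data.List using ([]; _∷_; _++_; map; filter; concatMap)
open import Data.List.Effectful using (module MonadProperties)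
import Data.List.Properties as LP
open import Data.Nat.ListAction using (sum)
open import Data.Nat.ListAction.Properties using (sum-++)
open import Data.Product using (_,_; proj₂)
open import Function using (_∘_)
open import Relation.Nullary using (¬_; Dec; yes; no)
open import Relation.Nullary.Decidable using (_×-dec_)
open import Relation.Binary.PropositionalEquality
  using (_≡_; _≗_; refl; sym; trans; cong; cong₂; subst; subst₂; module ≡-Reasoning)

infix 4 _≺_

_≺_ : ℕ → ℕ → Set
b ≺ a = b ≤ a × (0 < a → b < a)

0≺ : ∀ {a} → 0 ≺ a
0≺ = z≤n , λ 0<a → 0<a

≺-+ : ∀ {a b a′ b′} → a′ ≺ a → b′ ≺ b → a′ ℕ.+ b′ ≺ a ℕ.+ b
≺-+ {zero}  (a′≤a , _)    (b′≤b , b′<b) = ℕP.+-mono-≤ a′≤a b′≤b , ℕP.+-mono-≤-< a′≤a ∘ b′<b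
≺-+ {suc _} (a′≤a , a′<a) (b′≤b , _)    = ℕP.+-mono-≤ a′≤a b′≤b , λ _ → ℕP.+-mono-<-≤ (a′<a (s≤s z≤n)) b′≤b

≺-+-self : ∀ {a a′} → a′ ≺ a → a′ ℕ.+ a ≺ a ℕ.+ a
≺-+-self {zero}  (a′≤a , _)   = ℕP.+-monoˡ-≤ 0 a′≤a , λ ()
≺-+-self {suc a} (a′≤a , a′<a) =
  ℕP.+-monoˡ-≤ (suc a) a′≤a , λ _ → ℕP.+-monoˡ-< (suc a) (a′<a (s≤s z≤n))

-- InT2z with its two chains r + 2ℓ (r ≤ 1) merged into the single index k.
record T² (c : ℤ → ℕ) : Set where
  field
    symmetric  : ∀ i → c (- i) ≡ c i
    decreasing : ∀ k → c (+ (2 ℕ.+ k)) ≺ c (+ k)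
open T²

T²-cong : ∀ {f g} → f ≗ g → T² f → T² g
T²-cong f≗g t .symmetric i = trans (sym (f≗g (- i))) (trans (symmetric t i) (f≗g i))
T²-cong f≗g t .decreasing k = subst₂ _≺_ (f≗g _) (f≗g _) (decreasing t k)

T²-zero : T² (λ _ → 0)
T²-zero .symmetric _ = refl
T²-zero .decreasing _ = 0≺

T²-+ : ∀ {f g} → T² f → T² g → T² (λ m → f m ℕ.+ g m)
T²-+ s t .symmetric i = cong₂ ℕ._+_ (symmetric s i) (symmetric t i)
T²-+ s t .decreasing k = ≺-+ (decreasing s k) (decreasing t k)

T²-z+z⁻¹ : ∀ {c} → T² c → T² (λ m → c (m + 1ℤ) ℕ.+ c (m - 1ℤ))
T²-z+z⁻¹ {c} t .symmetric i = begin
  c (- i + 1ℤ) ℕ.+ c (- i - 1ℤ)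
    ≡⟨ cong₂ ℕ._+_ (cong c (ℤP.neg-distrib-+ i -1ℤ)) (cong c (ℤP.neg-distrib-+ i 1ℤ)) ⟨
  c (- (i - 1ℤ)) ℕ.+ c (- (i + 1ℤ))
    ≡⟨ cong₂ ℕ._+_ (symmetric t (i - 1ℤ)) (symmetric t (i + 1ℤ)) ⟩
  c (i - 1ℤ) ℕ.+ c (i + 1ℤ)
    ≡⟨ ℕP.+-comm (c (i - 1ℤ)) (c (i + 1ℤ)) ⟩
  c (i + 1ℤ) ℕ.+ c (i - 1ℤ)
    ∎
  where open ≡-Reasoning
T²-z+z⁻¹ {c} t .decreasing zero =
  -- at k = 0 the second summands are c 1 and c (-1), equal by symmetry
  subst (λ x → c (+ 3) ℕ.+ c (+ 1) ≺ c (+ 1) ℕ.+ x) (sym (symmetric t (+ 1))) (≺-+-self (decreasing t 1))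
T²-z+z⁻¹ t .decreasing (suc k) = ≺-+ (decreasing t (suc k ℕ.+ 1)) (decreasing t k)

T²⇒InT2z : ∀ {c} → T² c → InT2z c
T²⇒InT2z {c} t = symmetric t , λ r ℓ _ →
  subst (λ k → c (+ k) ≺ c (+ (r ℕ.+ 2 ℕ.* ℓ))) (sym (index r ℓ)) (decreasing t (r ℕ.+ 2 ℕ.* ℓ))
  where
  open +-*-Solver
  index : ∀ r ℓ → r ℕ.+ 2 ℕ.* (ℓ ℕ.+ 1) ≡ 2 ℕ.+ (r ℕ.+ 2 ℕ.* ℓ)
  index = solve 2 (λ r ℓ → r :+ con 2 :* (ℓ :+ con 1) := con 2 :+ (r :+ con 2 :* ℓ)) refl

infixl 7 _·_
infixr 6 _⋆_
infix 8 z^_q^_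

_·_ : Mono → Mono → Mono
a · b = mono (coeff a ℕ.* coeff b) (zexp a + zexp b) (qexp a ℕ.+ qexp b)

_⋆_ : Mono → Poly → Poly
a ⋆ r = map (a ·_) r

z^_q^_ : ℤ → ℕ → Mono
z^ i q^ j = mono 1 i j

mono-cong : ∀ {x x′ i i′ j j′} → x ≡ x′ → i ≡ i′ → j ≡ j′ → mono x i j ≡ mono x′ i′ j′
mono-cong refl refl refl = refl

·-assoc : ∀ a b c → (a · b) · c ≡ a · (b · c)
·-assoc a b c = mono-cong (ℕP.*-assoc (coeff a) (coeff b) (coeff c))
                      (ℤP.+-assoc (zexp a) (zexp b) (zexp c))
                      (ℕP.+-assoc (qexp a) (qexp b) (qexp c))

·-identityˡ : ∀ b → z^ 0ℤ q^ 0 · b ≡ b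
·-identityˡ (mono x i j) = mono-cong (ℕP.+-identityʳ x) (ℤP.+-identityˡ i) refl

⋆-⋆ : ∀ a b r → a ⋆ b ⋆ r ≡ (a · b) ⋆ r
⋆-⋆ a b r = trans (sym (LP.map-∘ r)) (LP.map-cong (λ c → sym (·-assoc a b c)) r)

⊗-identityˡ : ∀ r → one ⊗ r ≡ r
⊗-identityˡ r = trans (LP.++-identityʳ (z^ 0ℤ q^ 0 ⋆ r)) (trans (LP.map-cong ·-identityˡ r) (LP.map-id r))

⋆-⊗ : ∀ a q r → (a ⋆ q) ⊗ r ≡ a ⋆ (q ⊗ r)
⋆-⊗ a q r = begin
  (a ⋆ q) ⊗ r                       ≡⟨ LP.concatMap-map (_⋆ r) (a ·_) q ⟩
  concatMap (λ b → (a · b) ⋆ r) q   ≡⟨ LP.concatMap-cong (λ b → ⋆-⋆ a b r) q ⟨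
  concatMap (λ b → a ⋆ b ⋆ r) q     ≡⟨ LP.map-concatMap (a ·_) (_⋆ r) q ⟨
  a ⋆ (q ⊗ r)                       ∎
  where open ≡-Reasoning

⊗-assoc : ∀ p q r → (p ⊗ q) ⊗ r ≡ p ⊗ (q ⊗ r)
⊗-assoc p q r = trans (sym (MonadProperties.associative p (_⋆ q) (_⋆ r)))
                      (LP.concatMap-cong (λ a → ⋆-⊗ a q r) p)

has-exponents? : ∀ m n (a : Mono) → Dec (zexp a ≡ m × qexp a ≡ n)
has-exponents? m n a = (zexp a ℤP.≟ m) ×-dec (qexp a ℕP.≟ n)

coeffAt-++ : ∀ p r m n → coeffAt (p ++ r) m n ≡ coeffAt p m n ℕ.+ coeffAt r m n
coeffAt-++ p r m n = begin
  sum (map coeff (filter P? (p ++ r)))                      ≡⟨ cong (sum ∘ map coeff) (LP.filter-++ P? p r) ⟩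
  sum (map coeff (filter P? p ++ filter P? r))              ≡⟨ cong sum (LP.map-++ coeff (filter P? p) _) ⟩
  sum (map coeff (filter P? p) ++ map coeff (filter P? r))  ≡⟨ sum-++ (map coeff (filter P? p)) _ ⟩
  coeffAt p m n ℕ.+ coeffAt r m n                           ∎
  where
  open ≡-Reasoning
  P? = has-exponents? m n

coeffAt-∷-accept : ∀ {b r m n} → zexp b ≡ m × qexp b ≡ n →
                   coeffAt (b ∷ r) m n ≡ coeff b ℕ.+ coeffAt r m n
coeffAt-∷-accept {m = m} {n} e = cong (sum ∘ map coeff) (LP.filter-accept (has-exponents? m n) e)

coeffAt-∷-reject : ∀ {b r m n} → ¬ (zexp b ≡ m × qexp b ≡ n) → coeffAt (b ∷ r) m n ≡ coeffAt r m n
coeffAt-∷-reject {m = m} {n} ne = cong (sum ∘ map coeff) (LP.filter-reject (has-exponents? m n) ne)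

i+[j-i]≡j : ∀ i j → i + (j - i) ≡ j
i+[j-i]≡j i j = trans (sym (ℤP.+-assoc i j (- i))) (xyx⁻¹≈y i j)

coeffAt-⋆-≤ : ∀ i j {n} r m → j ≤ n → coeffAt (z^ i q^ j ⋆ r) m n ≡ coeffAt r (m - i) (n ∸ j)
coeffAt-⋆-≤ i j [] m j≤n = refl
coeffAt-⋆-≤ i j {n} (b ∷ r) m j≤n with has-exponents? (m - i) (n ∸ j) b
... | yes (i≡ , j≡) = begin
  coeffAt (z^ i q^ j · b ∷ z^ i q^ j ⋆ r) m n        ≡⟨ coeffAt-∷-accept (exponents-sum i≡ j≡) ⟩
  1 ℕ.* coeff b ℕ.+ coeffAt (z^ i q^ j ⋆ r) m n      ≡⟨ cong₂ ℕ._+_ (ℕP.*-identityˡ (coeff b)) (coeffAt-⋆-≤ i j r m j≤n) ⟩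
  coeff b ℕ.+ coeffAt r (m - i) (n ∸ j)              ≡⟨ coeffAt-∷-accept (i≡ , j≡) ⟨
  coeffAt (b ∷ r) (m - i) (n ∸ j)                    ∎
  where
  open ≡-Reasoning
  exponents-sum : zexp b ≡ m - i → qexp b ≡ n ∸ j → i + zexp b ≡ m × j ℕ.+ qexp b ≡ n
  exponents-sum refl refl = i+[j-i]≡j i m , ℕP.m+[n∸m]≡n j≤n
... | no ¬≡ = trans (coeffAt-∷-reject (¬≡ ∘ exponents-difference))
                    (trans (coeffAt-⋆-≤ i j r m j≤n) (sym (coeffAt-∷-reject ¬≡)))
  where
  exponents-difference : i + zexp b ≡ m × j ℕ.+ qexp b ≡ n → zexp b ≡ m - i × qexp b ≡ n ∸ j
  exponents-difference (refl , refl) = sym (xyx⁻¹≈y i (zexp b)) , sym (ℕP.m+n∸m≡n j (qexp b))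

coeffAt-⋆-> : ∀ i j {n} r m → n < j → coeffAt (z^ i q^ j ⋆ r) m n ≡ 0
coeffAt-⋆-> i j [] m n<j = refl
coeffAt-⋆-> i j (b ∷ r) m n<j =
  trans (coeffAt-∷-reject {z^ i q^ j · b} {z^ i q^ j ⋆ r} {m} (j+q≢n ∘ proj₂)) (coeffAt-⋆-> i j r m n<j)
  where
  j+q≢n : j ℕ.+ qexp b ≢ _
  j+q≢n refl = ℕP.m+n≮m j (qexp b) n<j

T²-shifted : ∀ {j n} {f : ℤ → ℕ} {g : ℕ → ℤ → ℕ} → (∀ n′ → T² (g n′)) →
  (j ≤ n → ∀ m → f m ≡ g (n ∸ j) m) → (n < j → ∀ m → f m ≡ 0) → T² f
T²-shifted {j} {n} t f≡g f≡0 with j ≤? n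
... | yes j≤n = T²-cong (sym ∘ f≡g j≤n) (t (n ∸ j))
... | no  j≰n = T²-cong (sym ∘ f≡0 (ℕP.≰⇒> j≰n)) T²-zero

record T²ᵖ (p : Poly) : Set where
  field
    coefficient : ∀ n → T² (λ m → coeffAt p m n)
open T²ᵖ

T²ᵖ-one : T²ᵖ one
T²ᵖ-one .coefficient n .symmetric i with i ℤP.≟ 0ℤ
... | yes refl = refl
... | no  i≢0  = trans (coeffAt-one-≢0 (i≢0 ∘ ℤP.neg-injective)) (sym (coeffAt-one-≢0 i≢0))
  where
  coeffAt-one-≢0 : ∀ {m} → m ≢ 0ℤ → coeffAt one m n ≡ 0
  coeffAt-one-≢0 m≢0 = coeffAt-∷-reject (λ (0≡m , _) → m≢0 (sym 0≡m))
T²ᵖ-one .coefficient n .decreasing k = 0≺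

T²ᵖ-++ : ∀ {p r} → T²ᵖ p → T²ᵖ r → T²ᵖ (p ++ r)
T²ᵖ-++ {p} {r} tp tr .coefficient n =
  T²-cong (λ m → sym (coeffAt-++ p r m n)) (T²-+ (coefficient tp n) (coefficient tr n))

T²ᵖ-q^ : ∀ {r} j → T²ᵖ r → T²ᵖ (z^ 0ℤ q^ j ⋆ r)
T²ᵖ-q^ {r} j t .coefficient n = T²-shifted (coefficient t)
  (λ j≤n m → trans (coeffAt-⋆-≤ 0ℤ j r m j≤n)
                   (cong (λ m′ → coeffAt r m′ (n ∸ j)) (ℤP.+-identityʳ m)))
  (λ n<j m → coeffAt-⋆-> 0ℤ j r m n<j)

T²ᵖ-z+z⁻¹ : ∀ {r} j → T²ᵖ r → T²ᵖ (z^ -1ℤ q^ j ⋆ r ++ z^ 1ℤ q^ j ⋆ r)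
T²ᵖ-z+z⁻¹ {r} j t .coefficient n = T²-shifted (T²-z+z⁻¹ ∘ coefficient t)
  (λ j≤n m → trans (coeffAt-++ (z^ -1ℤ q^ j ⋆ r) _ m n)
                   (cong₂ ℕ._+_ (coeffAt-⋆-≤ -1ℤ j r m j≤n) (coeffAt-⋆-≤ 1ℤ j r m j≤n)))
  (λ n<j m → trans (coeffAt-++ (z^ -1ℤ q^ j ⋆ r) _ m n)
                   (cong₂ ℕ._+_ (coeffAt-⋆-> -1ℤ j r m n<j) (coeffAt-⋆-> 1ℤ j r m n<j)))

factor-⊗ : ∀ ℓ r → factor ℓ ⊗ r ≡
  z^ 0ℤ q^ 0 ⋆ r ++ (z^ -1ℤ q^ ℓ ⋆ r ++ z^ 1ℤ q^ ℓ ⋆ r) ++ z^ 0ℤ q^ (ℓ ℕ.+ ℓ) ⋆ r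
factor-⊗ ℓ r = cong (z^ 0ℤ q^ 0 ⋆ r ++_) (begin
  z^ -1ℤ q^ ℓ ⋆ r ++ z^ 1ℤ q^ (ℓ ℕ.+ 0) ⋆ r ++ z^ 0ℤ q^ (ℓ ℕ.+ ℓ) ⋆ r ++ []
    ≡⟨ cong₂ (λ j s → z^ -1ℤ q^ ℓ ⋆ r ++ z^ 1ℤ q^ j ⋆ r ++ s)
             (ℕP.+-identityʳ ℓ) (LP.++-identityʳ _) ⟩
  z^ -1ℤ q^ ℓ ⋆ r ++ z^ 1ℤ q^ ℓ ⋆ r ++ z^ 0ℤ q^ (ℓ ℕ.+ ℓ) ⋆ r
    ≡⟨ LP.++-assoc (z^ -1ℤ q^ ℓ ⋆ r) _ _ ⟨
  (z^ -1ℤ q^ ℓ ⋆ r ++ z^ 1ℤ q^ ℓ ⋆ r) ++ z^ 0ℤ q^ (ℓ ℕ.+ ℓ) ⋆ r ∎)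
  where open ≡-Reasoning

T²ᵖ-factor-⊗ : ∀ ℓ {r} → T²ᵖ r → T²ᵖ (factor ℓ ⊗ r)
T²ᵖ-factor-⊗ ℓ {r} t = subst T²ᵖ (sym (factor-⊗ ℓ r))
  (T²ᵖ-++ (T²ᵖ-q^ 0 t) (T²ᵖ-++ (T²ᵖ-z+z⁻¹ ℓ t) (T²ᵖ-q^ (ℓ ℕ.+ ℓ) t)))

T²ᵖ-factor^-⊗ : ∀ ℓ k {r} → T²ᵖ r → T²ᵖ ((factor ℓ ^ᵖ k) ⊗ r)
T²ᵖ-factor^-⊗ ℓ zero    {r} t = subst T²ᵖ (sym (⊗-identityˡ r)) t
T²ᵖ-factor^-⊗ ℓ (suc k) {r} t = subst T²ᵖ (sym (⊗-assoc (factor ℓ) (factor ℓ ^ᵖ k) r))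
  (T²ᵖ-factor-⊗ ℓ (T²ᵖ-factor^-⊗ ℓ k t))

T²ᵖ-prodUpTo : ∀ mult N → T²ᵖ (prodUpTo mult N)
T²ᵖ-prodUpTo mult zero    = T²ᵖ-one
T²ᵖ-prodUpTo mult (suc N) = T²ᵖ-factor^-⊗ (suc N) (mult (suc N)) (T²ᵖ-prodUpTo mult N)

theorem3p8 : (mult : ℕ → ℕ) →
    InT2zq (dS mult) ×
    (∀ (m n : ℕ) → dS mult (+ m) n ≢ 0 → dS mult (+ m + + 2) n < dS mult (+ m) n)
theorem3p8 mult = (λ n → T²⇒InT2z (coefficient (T²ᵖ-prodUpTo mult n) n)) , strictly-decreasing
  where
  strictly-decreasing : ∀ m n → dS mult (+ m) n ≢ 0 → dS mult (+ m + + 2) n < dS mult (+ m) n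
  strictly-decreasing m n dS≢0 =
    subst (λ k → dS mult (+ k) n < dS mult (+ m) n) (ℕP.+-comm 2 m)
      (proj₂ (decreasing (coefficient (T²ᵖ-prodUpTo mult n) n) m) (ℕP.n≢0⇒n>0 dS≢0))
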